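{- Let $n\ge5$ be odd, $T=\langle n,3n-2,3n-1\rangle$, $\mathrm F(T)=\max(\mathbb Z\setminus T)$ and $S=T\cup\{\mathrm F(T)\}$. Then the following four integers belong to $\mathrm{Ap}(S,\mathrm F(T))$: $\frac{3n-3}{2}n+\frac{n-3}{2}(3n-2)$, $\; n+\frac{n-1}{2}(3n-2)$, $\;\frac{3n-5}{2}n+\frac{n-5}{2}(3n-2)+(3n-1)$, and $\frac{3n-3}{2}n+\frac{n-7}{2}(3n-2)+(3n-1)$.
   Context: For $m\in S\setminus\{0\}$, $\mathrm{Ap}(S,m)=\{s\in S: s-m\notin S\}$. -}

module Defs where

open import Data.Nat as ℕ using (ℕ)
open import Data.Integer using (ℤ; +_; _+_; _-_; _*_; _<_)
open import Data.Product using (∃; _×_)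
open import Data.Sum using (_⊎_)
open import Relation.Nullary using (¬_)
open import Relation.Binary.PropositionalEquality using (_≡_)

InT : ℕ → ℤ → Set
InT n x = ∃ λ a → ∃ λ b → ∃ λ c →
  x ≡ (+ a) * (+ n) + (+ b) * (+ 3 * + n - + 2) + (+ c) * (+ 3 * + n - + 1)

IsMaxGap : ℕ → ℤ → Set
IsMaxGap n F = ¬ InT n F × (∀ x → F < x → InT n x)

InS : ℕ → ℤ → ℤ → Set
InS n F x = InT n x ⊎ x ≡ F

InAp : ℕ → ℤ → ℤ → ℤ → Set
InAp n F m s = InS n F s × ¬ InS n F (s - m)

module Submission where

-- Put g₂ = 3n - 2 and g₃ = 3n - 1. An element a n + b g₂ + c g₃ of T, with u = b + c, equals
-- n (a + 3u) - j where j = 2b + c ≤ 2u; conversely every y with n X - 2u ≤ y ≤ n X and 3u ≤ X lies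
-- in T. Hence y ∉ T as soon as y ≡ -r (mod n) with 0 ≤ r < n and y < ⌈r/2⌉ g₂, since any
-- representation would need 2u ≥ r. For n = 5 + 2h this singles out F = n (5 + 3h) - (3 + 2h)
-- = 22 + 23h + 6h², and two such intervals cover F + 1, …, F + n, so together with the multiples
-- of n every y > F is in T.
-- Each of the four numbers is F + w with F + w ∈ T, w ≠ F and w ∉ T: w = F - 1 and w = 9 + 4h
-- by the residue argument, w = F - n and w = F - g₂ because F ∉ T.

module _ where
  open import Data.Nat
  open import Data.Nat.Properties
  open import Data.Nat.DivMod using (_/_; _%_; m≡m%n+[m/n]*n; m%n<n; m*n/n≡m)
  open import Data.Nat.Tactic.RingSolver using (solve)
  open import Data.Integer as ℤ using (ℤ; +_; +<+)
  open import Data.Integer.DivMod using (div-pos-is-/ℕ) renaming (_/_ to _/ℤ_)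
  open import Data.Integer.Properties as ℤ using (pos-*; +-injective; [+m]-[+n]≡m⊖n; ⊖-≥)
  open import Data.List using (_∷_; [])
  open import Data.Product using (∃-syntax; _×_; _,_)
  open import Data.Sum using (inj₁; inj₂)
  open import Data.Empty using (⊥-elim)
  open import Function.Base using (case_of_)
  open import Relation.Nullary using (¬_; yes; no)
  open import Relation.Binary.Definitions using (tri<; tri≈; tri>)
  open import Relation.Binary.PropositionalEquality
  open import Defs

  -- The conclusion is spelled suc x ≤ y, not x < y, so that x and y are read off the expected
  -- type before the ring solver runs on the hypothesis.
  +suc≡⇒< : ∀ {x y} k → x + suc k ≡ y → suc x ≤ y
  +suc≡⇒< {x} k refl = m<m+n x z<s

  ≤-double-split : ∀ u j → j ≤ 2 * u → ∃[ b ] ∃[ c ] ∃[ d ] (j ≡ 2 * b + c × b + c + d ≡ u)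
  ≤-double-split u       zero          _ = 0 , 0 , u , refl , refl
  ≤-double-split (suc u) (suc zero)    _ = 0 , 1 , u , refl , refl
  ≤-double-split (suc u) (suc (suc j)) j+2≤2u+2
    with ≤-double-split u j (s≤s⁻¹ (s≤s⁻¹ (subst (2 + j ≤_) (*-suc 2 u) j+2≤2u+2)))
  ... | b , c , d , refl , refl = suc b , c , d , cong (_+ c) (sym (*-suc 2 b)) , refl

  multiple-gap : ∀ n {y j r X P} → y + j ≡ n * X → y + r ≡ n * P → j < r → n ≤ r
  multiple-gap n {y} {j} {r} {X} {P} y+j≡nX y+r≡nP j<r = +-cancelˡ-≤ y n r (begin
    y + n      ≤⟨ +-monoˡ-≤ n (m≤m+n y j) ⟩
    y + j + n  ≡⟨ cong (_+ n) y+j≡nX ⟩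
    n * X + n  ≡⟨ solve (n ∷ X ∷ []) ⟩
    n * suc X  ≤⟨ *-monoʳ-≤ n X<P ⟩
    n * P      ≡⟨ y+r≡nP ⟨
    y + r      ∎)
    where
    open ≤-Reasoning
    X<P : X < P
    X<P = *-cancelˡ-< n X P (begin-strict
      n * X  ≡⟨ y+j≡nX ⟨
      y + j  <⟨ +-monoʳ-< y j<r ⟩
      y + r  ≡⟨ y+r≡nP ⟩
      n * P  ∎)

  +[m+n]-+m≡+n : ∀ m n → + (m + n) ℤ.- + m ≡ + n
  +[m+n]-+m≡+n m n = begin
    + (m + n) ℤ.- + m  ≡⟨ [+m]-[+n]≡m⊖n (m + n) m ⟩
    (m + n) ℤ.⊖ m      ≡⟨ ⊖-≥ (m≤m+n m n) ⟩
    + (m + n ∸ m)      ≡⟨ cong +_ (m+n∸m≡n m n) ⟩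
    + n                ∎
    where open ≡-Reasoning

  halve : ∀ m c k → m ≡ c + k * 2 → (+ m ℤ.- + c) /ℤ + 2 ≡ + k
  halve _ c k refl = begin
    (+ (c + k * 2) ℤ.- + c) /ℤ + 2  ≡⟨ cong (_/ℤ + 2) (+[m+n]-+m≡+n c (k * 2)) ⟩
    + (k * 2) /ℤ + 2                ≡⟨ div-pos-is-/ℕ (+ (k * 2)) 2 ⟩
    + (k * 2 / 2)                   ≡⟨ cong +_ (m*n/n≡m k 2) ⟩
    + k                             ∎
    where open ≡-Reasoning

  module NumericalSemigroup (n g₂ g₃ : ℕ) (3n≡2+g₂ : 3 * n ≡ 2 + g₂) (g₃≡1+g₂ : g₃ ≡ 1 + g₂) where

    infix 4 _∈T

    _∈T : ℕ → Set
    y ∈T = ∃[ a ] ∃[ b ] ∃[ c ] y ≡ a * n + b * g₂ + c * g₃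

    ∈T-+ : ∀ {x y} → x ∈T → y ∈T → x + y ∈T
    ∈T-+ (a , b , c , refl) (a′ , b′ , c′ , refl) =
      a + a′ , b + b′ , c + c′ , solve (a ∷ b ∷ c ∷ a′ ∷ b′ ∷ c′ ∷ n ∷ g₂ ∷ g₃ ∷ [])

    *n∈T : ∀ q → q * n ∈T
    *n∈T q = q , 0 , 0 , solve (q ∷ n ∷ [])

    n∈T : n ∈T
    n∈T = 1 , 0 , 0 , solve (n ∷ [])

    g₂∈T : g₂ ∈T
    g₂∈T = 0 , 1 , 0 , solve (g₂ ∷ [])

    deficit : ∀ a b c → a * n + b * g₂ + c * g₃ + (2 * b + c) ≡ n * (a + 3 * (b + c))
    deficit a b c = begin
      a * n + b * g₂ + c * g₃ + (2 * b + c)        ≡⟨ cong (λ g → a * n + b * g₂ + c * g + (2 * b + c)) g₃≡1+g₂ ⟩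
      a * n + b * g₂ + c * (1 + g₂) + (2 * b + c)  ≡⟨ solve (a ∷ b ∷ c ∷ n ∷ g₂ ∷ []) ⟩
      a * n + (b + c) * (2 + g₂)                   ≡⟨ cong (λ g → a * n + (b + c) * g) 3n≡2+g₂ ⟨
      a * n + (b + c) * (3 * n)                    ≡⟨ solve (a ∷ b ∷ c ∷ n ∷ []) ⟩
      n * (a + 3 * (b + c))                        ∎
      where open ≡-Reasoning

    ∈T-near-multiple : ∀ a u {y} → y ≤ n * (a + 3 * u) → n * (a + 3 * u) ≤ y + 2 * u → y ∈T
    ∈T-near-multiple a u {y} y≤nX nX≤y+2u
      with ≤-double-split u (n * (a + 3 * u) ∸ y) (m≤n+o⇒m∸n≤o _ y nX≤y+2u)
    ... | b , c , d , j≡2b+c , b+c+d≡u = a + 3 * d , b , c , +-cancelʳ-≡ j y _ (begin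
      y + j                                            ≡⟨ m+[n∸m]≡n y≤nX ⟩
      n * (a + 3 * u)                                  ≡⟨ cong (λ v → n * (a + 3 * v)) b+c+d≡u ⟨
      n * (a + 3 * (b + c + d))                        ≡⟨ solve (n ∷ a ∷ b ∷ c ∷ d ∷ []) ⟩
      n * (a + 3 * d + 3 * (b + c))                    ≡⟨ deficit (a + 3 * d) b c ⟨
      (a + 3 * d) * n + b * g₂ + c * g₃ + (2 * b + c)  ≡⟨ cong (λ k → (a + 3 * d) * n + b * g₂ + c * g₃ + k) j≡2b+c ⟨
      (a + 3 * d) * n + b * g₂ + c * g₃ + j            ∎)
      where
      open ≡-Reasoning
      j : ℕ
      j = n * (a + 3 * u) ∸ y

    ∉T-criterion : ∀ y r P B → y + r ≡ n * P → r < n → y < B * g₂ → 2 * B ≤ suc r → ¬ y ∈T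
    ∉T-criterion _ r P B y+r≡nP r<n y<Bg₂ 2B≤1+r (a , b , c , refl) =
      <⇒≱ r<n (multiple-gap n (deficit a b c) y+r≡nP 2b+c<r)
      where
      open ≤-Reasoning
      b+c<B : b + c < B
      b+c<B = *-cancelʳ-< g₂ (b + c) B (≤-<-trans (begin
        (b + c) * g₂                   ≤⟨ m≤m+n _ (a * n + c) ⟩
        (b + c) * g₂ + (a * n + c)     ≡⟨ solve (a ∷ b ∷ c ∷ n ∷ g₂ ∷ []) ⟩
        a * n + b * g₂ + c * (1 + g₂)  ≡⟨ cong (λ g → a * n + b * g₂ + c * g) g₃≡1+g₂ ⟨
        a * n + b * g₂ + c * g₃        ∎) y<Bg₂)
      2b+c<r : 2 * b + c < r
      2b+c<r = s≤s⁻¹ (begin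
        2 + (2 * b + c)      ≤⟨ +-monoʳ-≤ 2 (+-monoʳ-≤ (2 * b) (m≤n*m c 2)) ⟩
        2 + (2 * b + 2 * c)  ≡⟨ solve (b ∷ c ∷ []) ⟩
        2 * suc (b + c)      ≤⟨ *-monoʳ-≤ 2 b+c<B ⟩
        2 * B                ≤⟨ 2B≤1+r ⟩
        suc r                ∎)

    G₂ G₃ : ℤ
    G₂ = + 3 ℤ.* + n ℤ.- + 2
    G₃ = + 3 ℤ.* + n ℤ.- + 1

    G₂≡+g₂ : G₂ ≡ + g₂
    G₂≡+g₂ = begin
      + 3 ℤ.* + n ℤ.- + 2  ≡⟨ cong (ℤ._- + 2) (pos-* 3 n) ⟨
      + (3 * n) ℤ.- + 2    ≡⟨ cong (λ m → + m ℤ.- + 2) 3n≡2+g₂ ⟩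
      + (2 + g₂) ℤ.- + 2   ≡⟨ +[m+n]-+m≡+n 2 g₂ ⟩
      + g₂                 ∎
      where open ≡-Reasoning

    G₃≡+g₃ : G₃ ≡ + g₃
    G₃≡+g₃ = begin
      + 3 ℤ.* + n ℤ.- + 1  ≡⟨ cong (ℤ._- + 1) (pos-* 3 n) ⟨
      + (3 * n) ℤ.- + 1    ≡⟨ cong (λ m → + m ℤ.- + 1) (trans 3n≡2+g₂ (cong suc (sym g₃≡1+g₂))) ⟩
      + (1 + g₃) ℤ.- + 1   ≡⟨ +[m+n]-+m≡+n 1 g₃ ⟩
      + g₃                 ∎
      where open ≡-Reasoning

    +-combination : ∀ a b c → + a ℤ.* + n ℤ.+ + b ℤ.* G₂ ℤ.+ + c ℤ.* G₃ ≡ + (a * n + b * g₂ + c * g₃)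
    +-combination a b c = begin
      + a ℤ.* + n ℤ.+ + b ℤ.* G₂ ℤ.+ + c ℤ.* G₃
        ≡⟨ cong₂ (λ x y → + a ℤ.* + n ℤ.+ + b ℤ.* x ℤ.+ + c ℤ.* y) G₂≡+g₂ G₃≡+g₃ ⟩
      + a ℤ.* + n ℤ.+ + b ℤ.* + g₂ ℤ.+ + c ℤ.* + g₃
        ≡⟨ cong₂ ℤ._+_ (cong₂ ℤ._+_ (pos-* a n) (pos-* b g₂)) (pos-* c g₃) ⟨
      + (a * n + b * g₂ + c * g₃)
        ∎
      where open ≡-Reasoning

    ∈T⇒InT : ∀ {y} → y ∈T → InT n (+ y)
    ∈T⇒InT (a , b , c , refl) = a , b , c , sym (+-combination a b c)

    InT⇒∈T : ∀ {y} → InT n (+ y) → y ∈T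
    InT⇒∈T (a , b , c , y≡) = a , b , c , +-injective (trans y≡ (+-combination a b c))

    IsMaxGap-unique : ∀ {F} → ¬ F ∈T → (∀ {y} → F < y → y ∈T) → ∀ F′ → IsMaxGap n F′ → F′ ≡ + F
    IsMaxGap-unique {F} F∉T F<⇒∈T F′ (F′∉T , F′<⇒InT) with ℤ.<-cmp F′ (+ F)
    ... | tri< F′<F _ _      = ⊥-elim (F∉T (InT⇒∈T (F′<⇒InT (+ F) F′<F)))
    ... | tri≈ _ F′≡F _      = F′≡F
    ... | tri> _ _ (+<+ F<y) = ⊥-elim (F′∉T (∈T⇒InT (F<⇒∈T F<y)))

    ∈Ap : ∀ {F′ F w s} → F′ ≡ + F → (F+w∈T : F + w ∈T) → ¬ w ∈T → w < F →
          (let (a , b , c , _) = F+w∈T in s ≡ + a ℤ.* + n ℤ.+ + b ℤ.* G₂ ℤ.+ + c ℤ.* G₃) → InAp n F′ F′ s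
    ∈Ap {F = F} {w} {s} refl (a , b , c , F+w≡) w∉T w<F s≡ =
      inj₁ (a , b , c , s≡) , λ where
        (inj₁ s-F∈T) → w∉T (InT⇒∈T (subst (InT n) s-F≡w s-F∈T))
        (inj₂ s-F≡F) → <⇒≢ w<F (+-injective (trans (sym s-F≡w) s-F≡F))
      where
      s-F≡w : s ℤ.- + F ≡ + w
      s-F≡w = trans (cong (ℤ._- + F) (trans s≡ (trans (+-combination a b c) (cong +_ (sym F+w≡)))))
                    (+[m+n]-+m≡+n F w)

  module OddCase (h : ℕ) where
    open NumericalSemigroup (5 + 2 * h) (13 + 6 * h) (14 + 6 * h) (solve (h ∷ [])) refl public

    -- Statements proved with the ring solver spell n and F out: it treats defined names as constants.
    n F : ℕ
    n = 5 + 2 * h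
    F = 22 + 23 * h + 6 * (h * h)

    -- F + 1, …, F + n are covered by [n X - 2u, n X] for (X, u) = (5 + 3h, 1 + h) and (6 + 3h, 2 + h).
    window : ∀ r → r < n → suc F + r ∈T
    window r r<n =
      let F = 22 + 23 * h + 6 * (h * h) in
      case r ≤? 2 + 2 * h of λ where
        (yes r≤2+2h) → ∈T-near-multiple 2 (1 + h)
          (begin
            suc F + r                        ≤⟨ +-monoʳ-≤ (suc F) r≤2+2h ⟩
            suc F + (2 + 2 * h)              ≡⟨ solve (h ∷ []) ⟩
            (5 + 2 * h) * (2 + 3 * (1 + h))  ∎)
          (begin
            (5 + 2 * h) * (2 + 3 * (1 + h))  ≡⟨ solve (h ∷ []) ⟩
            suc F + 0 + 2 * (1 + h)          ≤⟨ +-monoˡ-≤ (2 * (1 + h)) (+-monoʳ-≤ (suc F) z≤n) ⟩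
            suc F + r + 2 * (1 + h)          ∎)
        (no r≰2+2h) → ∈T-near-multiple 0 (2 + h)
          (begin
            suc F + r                          ≤⟨ +-monoʳ-≤ (suc F) (s≤s⁻¹ r<n) ⟩
            suc F + (4 + 2 * h)                ≤⟨ m≤m+n _ (3 + 2 * h) ⟩
            suc F + (4 + 2 * h) + (3 + 2 * h)  ≡⟨ solve (h ∷ []) ⟩
            (5 + 2 * h) * (0 + 3 * (2 + h))    ∎)
          (begin
            (5 + 2 * h) * (0 + 3 * (2 + h))    ≡⟨ solve (h ∷ []) ⟩
            suc F + (3 + 2 * h) + 2 * (2 + h)  ≤⟨ +-monoˡ-≤ (2 * (2 + h)) (+-monoʳ-≤ (suc F) (≰⇒> r≰2+2h)) ⟩
            suc F + r + 2 * (2 + h)            ∎)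
      where open ≤-Reasoning

    above-Frobenius : ∀ d → suc F + d ∈T
    above-Frobenius d = subst _∈T (trans (+-assoc (suc F) (d % n) _) (cong (λ k → suc F + k) (sym (m≡m%n+[m/n]*n d n))))
                          (∈T-+ (window (d % n) (m%n<n d n)) (*n∈T (d / n)))

    Frobenius<⇒∈T : ∀ {y} → F < y → y ∈T
    Frobenius<⇒∈T F<y = subst _∈T (m+[n∸m]≡n F<y) (above-Frobenius _)

    Frobenius∉T : ¬ F ∈T
    Frobenius∉T = ∉T-criterion (22 + 23 * h + 6 * (h * h)) (3 + 2 * h) (5 + 3 * h) (2 + h)
      (solve (h ∷ [])) (n≤1+n _) (+suc≡⇒< (3 + 2 * h) (solve (h ∷ []))) (≤-reflexive (solve (h ∷ [])))

    IsMaxGap⇒≡F : ∀ F′ → IsMaxGap n F′ → F′ ≡ + F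
    IsMaxGap⇒≡F = IsMaxGap-unique Frobenius∉T Frobenius<⇒∈T

    w₁∉T : ¬ 21 + 23 * h + 6 * (h * h) ∈T
    w₁∉T = ∉T-criterion (21 + 23 * h + 6 * (h * h)) (4 + 2 * h) (5 + 3 * h) (2 + h)
      (solve (h ∷ [])) ≤-refl (+suc≡⇒< (4 + 2 * h) (solve (h ∷ []))) (m≤n⇒m≤1+n (≤-reflexive (solve (h ∷ []))))

    w₂∉T : ¬ 9 + 4 * h ∈T
    w₂∉T = ∉T-criterion (9 + 4 * h) 1 2 1 (solve (h ∷ [])) (s≤s (s≤s z≤n)) (+suc≡⇒< (3 + 2 * h) (solve (h ∷ []))) ≤-refl

    w₃∉T : ¬ 17 + 21 * h + 6 * (h * h) ∈T
    w₃∉T w₃∈T = Frobenius∉T (subst _∈T w₃+n≡F (∈T-+ w₃∈T n∈T))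
      where
      w₃+n≡F : 17 + 21 * h + 6 * (h * h) + (5 + 2 * h) ≡ 22 + 23 * h + 6 * (h * h)
      w₃+n≡F = solve (h ∷ [])

    w₄∉T : ¬ 9 + 17 * h + 6 * (h * h) ∈T
    w₄∉T w₄∈T = Frobenius∉T (subst _∈T w₄+g₂≡F (∈T-+ w₄∈T g₂∈T))
      where
      w₄+g₂≡F : 9 + 17 * h + 6 * (h * h) + (13 + 6 * h) ≡ 22 + 23 * h + 6 * (h * h)
      w₄+g₂≡F = solve (h ∷ [])

    w₁<F : 21 + 23 * h + 6 * (h * h) < 22 + 23 * h + 6 * (h * h)
    w₁<F = ≤-refl

    w₂<F : 9 + 4 * h < 22 + 23 * h + 6 * (h * h)
    w₂<F = +suc≡⇒< (12 + 19 * h + 6 * (h * h)) (solve (h ∷ []))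

    w₃<F : 17 + 21 * h + 6 * (h * h) < 22 + 23 * h + 6 * (h * h)
    w₃<F = +suc≡⇒< (4 + 2 * h) (solve (h ∷ []))

    w₄<F : 9 + 17 * h + 6 * (h * h) < 22 + 23 * h + 6 * (h * h)
    w₄<F = +suc≡⇒< (12 + 6 * h) (solve (h ∷ []))

    F+w₁∈T : 22 + 23 * h + 6 * (h * h) + (21 + 23 * h + 6 * (h * h)) ∈T
    F+w₁∈T = 6 + 3 * h , 1 + h , 0 , solve (h ∷ [])

    F+w₂∈T : 22 + 23 * h + 6 * (h * h) + (9 + 4 * h) ∈T
    F+w₂∈T = 1 , 2 + h , 0 , solve (h ∷ [])

    F+w₃∈T : 22 + 23 * h + 6 * (h * h) + (17 + 21 * h + 6 * (h * h)) ∈T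
    F+w₃∈T = 5 + 3 * h , h , 1 , solve (h ∷ [])

    [3n-3]/2≡6+3h : (+ 3 ℤ.* + n ℤ.- + 3) /ℤ + 2 ≡ + (6 + 3 * h)
    [3n-3]/2≡6+3h = halve (3 * (5 + 2 * h)) 3 (6 + 3 * h) (solve (h ∷ []))

    [3n-5]/2≡5+3h : (+ 3 ℤ.* + n ℤ.- + 5) /ℤ + 2 ≡ + (5 + 3 * h)
    [3n-5]/2≡5+3h = halve (3 * (5 + 2 * h)) 5 (5 + 3 * h) (solve (h ∷ []))

    [n-1]/2≡2+h : (+ n ℤ.- + 1) /ℤ + 2 ≡ + (2 + h)
    [n-1]/2≡2+h = halve (5 + 2 * h) 1 (2 + h) (solve (h ∷ []))

    [n-3]/2≡1+h : (+ n ℤ.- + 3) /ℤ + 2 ≡ + (1 + h)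
    [n-3]/2≡1+h = halve (5 + 2 * h) 3 (1 + h) (solve (h ∷ []))

    [n-5]/2≡h : (+ n ℤ.- + 5) /ℤ + 2 ≡ + h
    [n-5]/2≡h = halve (5 + 2 * h) 5 h (solve (h ∷ []))

    s₁-expansion : ((+ 3 ℤ.* + n ℤ.- + 3) /ℤ + 2) ℤ.* + n ℤ.+ ((+ n ℤ.- + 3) /ℤ + 2) ℤ.* G₂
                   ≡ + (6 + 3 * h) ℤ.* + n ℤ.+ + (1 + h) ℤ.* G₂ ℤ.+ + 0 ℤ.* G₃
    s₁-expansion = trans (cong₂ (λ A B → A ℤ.* + n ℤ.+ B ℤ.* G₂) [3n-3]/2≡6+3h [n-3]/2≡1+h) (sym (ℤ.+-identityʳ _))

    s₂-expansion : + n ℤ.+ ((+ n ℤ.- + 1) /ℤ + 2) ℤ.* G₂ ≡ + 1 ℤ.* + n ℤ.+ + (2 + h) ℤ.* G₂ ℤ.+ + 0 ℤ.* G₃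
    s₂-expansion = trans (cong₂ (λ A B → A ℤ.+ B ℤ.* G₂) (sym (ℤ.*-identityˡ (+ n))) [n-1]/2≡2+h) (sym (ℤ.+-identityʳ _))

    s₃-expansion : ((+ 3 ℤ.* + n ℤ.- + 5) /ℤ + 2) ℤ.* + n ℤ.+ ((+ n ℤ.- + 5) /ℤ + 2) ℤ.* G₂ ℤ.+ G₃
                   ≡ + (5 + 3 * h) ℤ.* + n ℤ.+ + h ℤ.* G₂ ℤ.+ + 1 ℤ.* G₃
    s₃-expansion = trans (cong₂ (λ A B → A ℤ.* + n ℤ.+ B ℤ.* G₂ ℤ.+ G₃) [3n-5]/2≡5+3h [n-5]/2≡h)
                         (cong (λ C → + (5 + 3 * h) ℤ.* + n ℤ.+ + h ℤ.* G₂ ℤ.+ C) (sym (ℤ.*-identityˡ G₃)))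

  [5+2h-7]/2≡h-1 : ∀ h → (+ (5 + 2 * h) ℤ.- + 7) /ℤ + 2 ≡ + h ℤ.- + 1
  [5+2h-7]/2≡h-1 zero    = refl
  [5+2h-7]/2≡h-1 (suc h) = halve (5 + 2 * suc h) 7 h (solve (h ∷ []))

  -- For n = 5 the coefficient (n - 7)/2 is -1, so the fourth number needs another decomposition.
  F+w₄∈T : ∀ h → let open OddCase h in 22 + 23 * h + 6 * (h * h) + (9 + 17 * h + 6 * (h * h)) ∈T
  F+w₄∈T zero    = 1 , 2 , 0 , refl
  F+w₄∈T (suc h) = 6 + 3 * suc h , h , 1 , solve (h ∷ [])

  s₄-expansion : ∀ h → let open OddCase h in
    ((+ 3 ℤ.* + n ℤ.- + 3) /ℤ + 2) ℤ.* + n ℤ.+ ((+ n ℤ.- + 7) /ℤ + 2) ℤ.* G₂ ℤ.+ G₃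
      ≡ (let (a , b , c , _) = F+w₄∈T h in + a ℤ.* + n ℤ.+ + b ℤ.* G₂ ℤ.+ + c ℤ.* G₃)
  s₄-expansion zero    = refl
  s₄-expansion (suc h) =
    trans (cong₂ (λ A B → A ℤ.* + n ℤ.+ B ℤ.* G₂ ℤ.+ G₃) [3n-3]/2≡6+3h ([5+2h-7]/2≡h-1 (suc h)))
          (cong (λ C → + (6 + 3 * suc h) ℤ.* + n ℤ.+ + h ℤ.* G₂ ℤ.+ C) (sym (ℤ.*-identityˡ G₃)))
    where open OddCase (suc h)

  odd⇒≡5+2* : ∀ n → 5 ≤ n → n % 2 ≡ 1 → ∃[ h ] n ≡ 5 + 2 * h
  odd⇒≡5+2* n 5≤n n%2≡1 = half-form (n / 2) 5≤n (trans (m≡m%n+[m/n]*n n 2) (cong (_+ (n / 2) * 2) n%2≡1))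
    where
    half-form : ∀ {n} k → 5 ≤ n → n ≡ 1 + k * 2 → ∃[ h ] n ≡ 5 + 2 * h
    half-form zero          (s≤s ())                   refl
    half-form (suc zero)    (s≤s (s≤s (s≤s ())))       refl
    half-form (suc (suc h)) _                          refl = h , solve (h ∷ [])

open import Defs
open import Data.Nat as ℕ using (ℕ; _≤_; _%_)
open import Data.Integer using (ℤ; +_; _+_; _-_; _*_)
open import Data.Integer.DivMod using (_/_)
open import Data.Product using (_×_)
open import Relation.Binary.PropositionalEquality using (_≡_)

open import Data.Product using (_,_)
open import Relation.Binary.PropositionalEquality using (refl)

mainTheorem3 : (n : ℕ) → 5 ≤ n → n % 2 ≡ 1 → (F : ℤ) → IsMaxGap n F →
    InAp n F F (((+ 3 * + n - + 3) / + 2) * + n + ((+ n - + 3) / + 2) * (+ 3 * + n - + 2))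
    × InAp n F F (+ n + ((+ n - + 1) / + 2) * (+ 3 * + n - + 2))
    × InAp n F F (((+ 3 * + n - + 5) / + 2) * + n + ((+ n - + 5) / + 2) * (+ 3 * + n - + 2) + (+ 3 * + n - + 1))
    × InAp n F F (((+ 3 * + n - + 3) / + 2) * + n + ((+ n - + 7) / + 2) * (+ 3 * + n - + 2) + (+ 3 * + n - + 1))
mainTheorem3 n 5≤n n-odd F′ gap with odd⇒≡5+2* n 5≤n n-odd
... | h , refl = ∈Ap F′≡+F F+w₁∈T w₁∉T w₁<F s₁-expansion
               , ∈Ap F′≡+F F+w₂∈T w₂∉T w₂<F s₂-expansion
               , ∈Ap F′≡+F F+w₃∈T w₃∉T w₃<F s₃-expansion
               , ∈Ap F′≡+F (F+w₄∈T h) w₄∉T w₄<F (s₄-expansion h)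
  where
  open OddCase h
  F′≡+F : F′ ≡ + F
  F′≡+F = IsMaxGap⇒≡F F′ gap
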